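{- Every path $P_n$ with $n\ge3$ vertices is uniquely $(3,2)$-colorable.
   Context: All graphs are simple, connected and undirected; $N_G(v)$ is the open neighborhood, $d(v)=|N_G(v)|$, $\Delta$ the maximum degree. For a coloring $c$ and vertex set $S$, $c(S)=\{c(u):u\in S\}$. For integers $k>0$ and $0<r\le\Delta(G)$ with $r\le k$, a conditional $(k,r)$-coloring of $G$ is a surjective map $c:V(G)\to\{1,\dots,k\}$ such that (C1) $c(u)\ne c(v)$ whenever $uv\in E(G)$, and (C2) $|c(N_G(v))|\ge\min\{d(v),r\}$ for every vertex $v$. $\chi_r(G)$ is the smallest $k$ for which $G$ has a conditional $(k,r)$-coloring. $G$ is uniquely $(k,r)$-colorable if $\chi_r(G)=k$ and every conditional $(k,r)$-coloring of $G$ induces the same partition of $V(G)$ into color classes. -}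

module Defs where

open import Data.Nat using (ℕ; suc; _≤_; _<_; _⊓_)
open import Data.Nat.Properties using () renaming (_≟_ to _≟ℕ_)
open import Data.Fin using (Fin; toℕ; _≟_)
open import Data.List using (List; length; map; filterᵇ; deduplicate; allFin)
open import Data.Bool using (Bool; true; _∨_)
open import Data.Product using (∃; _×_)
open import Relation.Binary.PropositionalEquality using (_≡_; _≢_)
open import Relation.Nullary using (¬_; ⌊_⌋)
open import Function.Bundles using (_⇔_)

Graph : ℕ → Set
Graph n = Fin n → Fin n → Bool

Path : (n : ℕ) → Graph n
Path n i j = ⌊ suc (toℕ i) ≟ℕ toℕ j ⌋ ∨ ⌊ suc (toℕ j) ≟ℕ toℕ i ⌋

N : ∀ {n} → Graph n → Fin n → List (Fin n)
N G v = filterᵇ (G v) (allFin _)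

deg : ∀ {n} → Graph n → Fin n → ℕ
deg G v = length (N G v)

nbrColours : ∀ {n k} → Graph n → (Fin n → Fin k) → Fin n → ℕ
nbrColours G c v = length (deduplicate _≟_ (map c (N G v)))

record IsConditionalColouring {n : ℕ} (G : Graph n) (k r : ℕ) (c : Fin n → Fin k) : Set where
  field
    surjective : ∀ (j : Fin k) → ∃ λ v → c v ≡ j
    proper     : ∀ u v → G u v ≡ true → c u ≢ c v
    condition  : ∀ v → deg G v ⊓ r ≤ nbrColours G c v

HasConditionalColouring : ∀ {n} → Graph n → ℕ → ℕ → Set
HasConditionalColouring G k r = ∃ λ c → IsConditionalColouring G k r c

ChiIs : ∀ {n} → Graph n → (r k : ℕ) → Set
ChiIs G r k = HasConditionalColouring G k r × (∀ k′ → k′ < k → ¬ HasConditionalColouring G k′ r)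

UniquelyColourable : ∀ {n} → Graph n → (k r : ℕ) → Set
UniquelyColourable {n} G k r =
  ChiIs G r k ×
  (∀ (c c′ : Fin n → Fin k) → IsConditionalColouring G k r c → IsConditionalColouring G k r c′ →
     ∀ u v → (c u ≡ c v) ⇔ (c′ u ≡ c′ v))

-- In a conditional (k,2)-colouring of a path, vertices at distance one or two get different colours:
-- distance one by properness, distance two because their common neighbour has degree two and must see
-- two colours. Hence any three consecutive vertices are coloured differently, and with only three
-- colours the colour of vertex i + 3 is forced to be that of vertex i. So every conditional
-- (3,2)-colouring has the residue classes mod 3 as colour classes, while the first three vertices
-- show that fewer than three colours are impossible.
module Submission where

open import Defs
open import Data.Nat using (ℕ; zero; suc; _≤_; _<_; _⊓_; z≤n; s≤s; _+_)
open import Data.Nat.Properties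
  using (≤-refl; ≤-reflexive; ≤-trans; ≤-<-trans; n≤1+n; m≤n+m; m⊓n≤n; ⊓-glb; suc-injective; 1+n≰n; m≢1+n+m;
         module ≤-Reasoning)
  renaming (_≟_ to _≟ℕ_)
open import Data.Fin using (Fin; zero; suc; toℕ; fromℕ<; inject≤; _≟_)
open import Data.Fin.Properties using (toℕ-injective; toℕ-fromℕ<; toℕ-inject≤; toℕ<n; pigeonhole; all?; <⇒≢)
open import Data.List using (List; []; _∷_; length; map; deduplicate; allFin)
open import Data.List.Membership.Propositional using (_∈_)
open import Data.List.Membership.Propositional.Properties
  using (∈-filter⁺; ∈-filter⁻; ∈-allFin; ∈-map⁻; ∈-deduplicate⁺; ∈-deduplicate⁻)
open import Data.List.Relation.Unary.Any using (here; there)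
open import Data.List.Relation.Unary.All using (_∷_)
open import Data.List.Relation.Unary.AllPairs using (_∷_)
open import Data.List.Relation.Unary.Unique.Propositional using (Unique)
open import Data.List.Relation.Unary.Unique.Propositional.Properties using (filter⁺; allFin⁺)
open import Data.List.Relation.Unary.Unique.DecPropositional.Properties using (deduplicate-!)
open import Data.Bool using (true; T?)
open import Data.Bool.Properties using (T-≡; ∨-comm)
open import Data.Product using (_,_; proj₂)
open import Data.Sum using (_⊎_; inj₁; inj₂; [_,_])
open import Relation.Nullary using (¬_; Dec; yes; no; ¬?; ⌊_⌋; contradiction)
open import Relation.Nullary.Decidable using (toWitness; _→-dec_)
open import Relation.Binary.Definitions using (DecidableEquality)
open import Relation.Binary.PropositionalEquality using (_≡_; _≢_; refl; sym; trans; cong; module ≡-Reasoning)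
open import Function using (_∘_; Injective)
open import Function.Bundles using (_⇔_; mk⇔; Equivalence)
import Function.Properties.Equivalence as ⇔

next₃ : Fin 3 → Fin 3
next₃ zero = suc zero
next₃ (suc zero) = suc (suc zero)
next₃ (suc (suc zero)) = zero

mod₃ : ℕ → Fin 3
mod₃ zero = zero
mod₃ (suc m) = next₃ (mod₃ m)

next₃-≢ : ∀ j → j ≢ next₃ j
next₃-≢ zero ()
next₃-≢ (suc zero) ()
next₃-≢ (suc (suc zero)) ()

next₃²-≢ : ∀ j → j ≢ next₃ (next₃ j)
next₃²-≢ zero ()
next₃²-≢ (suc zero) ()
next₃²-≢ (suc (suc zero)) ()

next₃³ : ∀ j → next₃ (next₃ (next₃ j)) ≡ j
next₃³ zero = refl
next₃³ (suc zero) = refl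
next₃³ (suc (suc zero)) = refl

mod₃-1+-≢ : ∀ {a b} → suc a ≡ b → mod₃ a ≢ mod₃ b
mod₃-1+-≢ refl = next₃-≢ _

mod₃-2+-≢ : ∀ {a b} → 2 + a ≡ b → mod₃ a ≢ mod₃ b
mod₃-2+-≢ refl = next₃²-≢ _

mod₃-toℕ : ∀ (j : Fin 3) → mod₃ (toℕ j) ≡ j
mod₃-toℕ zero = refl
mod₃-toℕ (suc zero) = refl
mod₃-toℕ (suc (suc zero)) = refl

Fin3-≢-≢⇒≡ : ∀ {x y z w : Fin 3} → x ≢ y → y ≢ z → x ≢ z → w ≢ y → w ≢ z → w ≡ x
Fin3-≢-≢⇒≡ {x} {y} {z} {w} = toWitness {a? = decided} _ x y z w
  where
  decided : Dec (∀ (x y z w : Fin 3) → x ≢ y → y ≢ z → x ≢ z → w ≢ y → w ≢ z → w ≡ x)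
  decided = all? λ x → all? λ y → all? λ z → all? λ w →
    ¬? (x ≟ y) →-dec ¬? (y ≟ z) →-dec ¬? (x ≟ z) →-dec ¬? (w ≟ y) →-dec ¬? (w ≟ z) →-dec w ≟ x

unique∧constant⇒length≤1 : ∀ {A : Set} {xs : List A} {a} → Unique xs → (∀ {x} → x ∈ xs → x ≡ a) →
                           length xs ≤ 1
unique∧constant⇒length≤1 {xs = []} _ _ = z≤n
unique∧constant⇒length≤1 {xs = _ ∷ []} _ _ = s≤s z≤n
unique∧constant⇒length≤1 {xs = _ ∷ _ ∷ _} ((x≢y ∷ _) ∷ _) ≡a =
  contradiction (trans (≡a (here refl)) (sym (≡a (there (here refl))))) x≢y

distinct-members⇒2≤length : ∀ {A : Set} {xs : List A} {a b} → a ∈ xs → b ∈ xs → a ≢ b → 2 ≤ length xs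
distinct-members⇒2≤length (here refl) (here refl) a≢b = contradiction refl a≢b
distinct-members⇒2≤length {xs = _ ∷ _ ∷ _} (here _) (there _) _ = s≤s (s≤s z≤n)
distinct-members⇒2≤length {xs = _ ∷ _ ∷ _} (there _) (here _) _ = s≤s (s≤s z≤n)
distinct-members⇒2≤length (there a∈) (there b∈) a≢b = ≤-trans (distinct-members⇒2≤length a∈ b∈ a≢b) (n≤1+n _)

module _ {A B : Set} (_≟B_ : DecidableEquality B) (f : A → B) where

  constant⇒dedup-length≤1 : ∀ xs {b} → (∀ {x} → x ∈ xs → f x ≡ b) →
                            length (deduplicate _≟B_ (map f xs)) ≤ 1
  constant⇒dedup-length≤1 xs f≡b = unique∧constant⇒length≤1 (deduplicate-! _≟B_ (map f xs)) image≡b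
    where
    image≡b : ∀ {y} → y ∈ deduplicate _≟B_ (map f xs) → y ≡ _
    image≡b y∈ with ∈-map⁻ f (∈-deduplicate⁻ _≟B_ (map f xs) y∈)
    ... | x , x∈ , refl = f≡b x∈

  distinguishing⇒length⊓2≤dedup-length : ∀ xs → Unique xs →
    (∀ {x y} → x ∈ xs → y ∈ xs → x ≢ y → f x ≢ f y) →
    length xs ⊓ 2 ≤ length (deduplicate _≟B_ (map f xs))
  distinguishing⇒length⊓2≤dedup-length [] _ _ = z≤n
  distinguishing⇒length⊓2≤dedup-length (_ ∷ []) _ _ = s≤s z≤n
  distinguishing⇒length⊓2≤dedup-length xs@(_ ∷ _ ∷ _) ((x≢y ∷ _) ∷ _) distinguishes =
    ≤-trans (m⊓n≤n (length xs) 2)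
      (distinct-members⇒2≤length (∈-deduplicate⁺ _≟B_ {xs = map f xs} (here refl))
                                 (∈-deduplicate⁺ _≟B_ {xs = map f xs} (there (here refl)))
                                 (distinguishes (here refl) (there (here refl)) x≢y))

module _ {n} (G : Graph n) where

  ∈-N⁺ : ∀ {v x} → G v x ≡ true → x ∈ N G v
  ∈-N⁺ {v} {x} e = ∈-filter⁺ (T? ∘ G v) (∈-allFin x) (Equivalence.from T-≡ e)

  ∈-N⁻ : ∀ {v x} → x ∈ N G v → G v x ≡ true
  ∈-N⁻ {v} x∈ = Equivalence.to T-≡ (proj₂ (∈-filter⁻ (T? ∘ G v) {xs = allFin _} x∈))

  N-unique : ∀ v → Unique (N G v)
  N-unique v = filter⁺ (T? ∘ G v) (allFin⁺ n)

  module _ {k} {c : Fin n → Fin k} where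

    monochromatic⇒nbrColours≤1 : ∀ {v κ} → (∀ {x} → x ∈ N G v → c x ≡ κ) → nbrColours G c v ≤ 1
    monochromatic⇒nbrColours≤1 {v} = constant⇒dedup-length≤1 _≟_ c (N G v)

    rainbow⇒condition : ∀ {v} → (∀ {x y} → x ∈ N G v → y ∈ N G v → x ≢ y → c x ≢ c y) →
                        deg G v ⊓ 2 ≤ nbrColours G c v
    rainbow⇒condition {v} = distinguishing⇒length⊓2≤dedup-length _≟_ c (N G v) (N-unique v)

    degree-two-neighbours-differ : ∀ {r} → IsConditionalColouring G k r c → 2 ≤ r →
      ∀ {m a b} → a ∈ N G m → b ∈ N G m → a ≢ b → (∀ {x} → x ∈ N G m → x ≡ a ⊎ x ≡ b) → c a ≢ c b
    degree-two-neighbours-differ {r} col 2≤r {m} {a} a∈ b∈ a≢b only-a-b ca≡cb = 1+n≰n (begin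
      2                            ≤⟨ ⊓-glb (distinct-members⇒2≤length a∈ b∈ a≢b) 2≤r ⟩
      deg G m ⊓ r                  ≤⟨ IsConditionalColouring.condition col m ⟩
      nbrColours G c m             ≤⟨ monochromatic⇒nbrColours≤1 coloured-ca ⟩
      1                            ∎)
      where
      open ≤-Reasoning
      coloured-ca : ∀ {x} → x ∈ N G m → c x ≡ c a
      coloured-ca x∈ = [ cong c , (λ x≡b → trans (cong c x≡b) (sym ca≡cb)) ] (only-a-b x∈)

fromℕ≤toℕ : ∀ {n i} (u : Fin n) → i ≤ toℕ u → Fin n
fromℕ≤toℕ u i≤u = fromℕ< (≤-<-trans i≤u (toℕ<n u))

toℕ-fromℕ≤toℕ : ∀ {n i} (u : Fin n) (i≤u : i ≤ toℕ u) → toℕ (fromℕ≤toℕ u i≤u) ≡ i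
toℕ-fromℕ≤toℕ u i≤u = toℕ-fromℕ< (≤-<-trans i≤u (toℕ<n u))

module _ {n : ℕ} where

  Path-sym : ∀ (u v : Fin n) → Path n u v ≡ Path n v u
  Path-sym u v = ∨-comm (⌊ suc (toℕ u) ≟ℕ toℕ v ⌋) (⌊ suc (toℕ v) ≟ℕ toℕ u ⌋)

  Path-edge⁺ : ∀ {u v : Fin n} → suc (toℕ u) ≡ toℕ v → Path n u v ≡ true
  Path-edge⁺ {u} {v} u→v with suc (toℕ u) ≟ℕ toℕ v
  ... | yes _ = refl
  ... | no ¬u→v = contradiction u→v ¬u→v

  Path-edge⁻ : ∀ {u v : Fin n} → Path n u v ≡ true → suc (toℕ u) ≡ toℕ v ⊎ suc (toℕ v) ≡ toℕ u
  Path-edge⁻ {u} {v} e with suc (toℕ u) ≟ℕ toℕ v | suc (toℕ v) ≟ℕ toℕ u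
  ... | yes u→v | _ = inj₁ u→v
  ... | no _ | yes v→u = inj₂ v→u
  Path-edge⁻ () | no _ | no _

  Path-middle-neighbours : ∀ {a m b x : Fin n} → suc (toℕ a) ≡ toℕ m → suc (toℕ m) ≡ toℕ b →
                           x ∈ N (Path n) m → x ≡ a ⊎ x ≡ b
  Path-middle-neighbours a→m m→b x∈ with Path-edge⁻ (∈-N⁻ (Path n) x∈)
  ... | inj₁ m→x = inj₂ (toℕ-injective (trans (sym m→x) m→b))
  ... | inj₂ x→m = inj₁ (toℕ-injective (suc-injective (trans x→m (sym a→m))))

  Path-neighbours-apart : ∀ {v x y : Fin n} → x ∈ N (Path n) v → y ∈ N (Path n) v → x ≢ y →
                          2 + toℕ x ≡ toℕ y ⊎ 2 + toℕ y ≡ toℕ x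
  Path-neighbours-apart x∈ y∈ x≢y with Path-edge⁻ (∈-N⁻ (Path n) x∈) | Path-edge⁻ (∈-N⁻ (Path n) y∈)
  ... | inj₁ v→x | inj₁ v→y = contradiction (toℕ-injective (trans (sym v→x) v→y)) x≢y
  ... | inj₂ x→v | inj₂ y→v = contradiction (toℕ-injective (suc-injective (trans x→v (sym y→v)))) x≢y
  ... | inj₁ v→x | inj₂ y→v = inj₂ (trans (cong suc y→v) v→x)
  ... | inj₂ x→v | inj₁ v→y = inj₁ (trans (cong suc x→v) v→y)

firstThree : ∀ {n} → 3 ≤ n → Fin 3 → Fin n
firstThree 3≤n j = inject≤ j 3≤n

module PathColouring {n k} {c : Fin n → Fin k} (col : IsConditionalColouring (Path n) k 2 c) where
  open IsConditionalColouring col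

  adjacent-differ : ∀ {u v} → suc (toℕ u) ≡ toℕ v → c u ≢ c v
  adjacent-differ = proper _ _ ∘ Path-edge⁺

  distance-two-differ : ∀ {u v} → 2 + toℕ u ≡ toℕ v → c u ≢ c v
  distance-two-differ {u} {v} u→→v =
    degree-two-neighbours-differ (Path n) col ≤-refl
      (∈-N⁺ (Path n) (trans (Path-sym m u) (Path-edge⁺ u→m))) (∈-N⁺ (Path n) (Path-edge⁺ m→v))
      (λ u≡v → m≢1+n+m (toℕ u) (trans (cong toℕ u≡v) (sym u→→v)))
      (Path-middle-neighbours u→m m→v)
    where
    1+u≤v : suc (toℕ u) ≤ toℕ v
    1+u≤v = ≤-trans (n≤1+n _) (≤-reflexive u→→v)
    m : Fin n
    m = fromℕ≤toℕ v 1+u≤v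
    u→m : suc (toℕ u) ≡ toℕ m
    u→m = sym (toℕ-fromℕ≤toℕ v 1+u≤v)
    m→v : suc (toℕ m) ≡ toℕ v
    m→v = trans (cong suc (toℕ-fromℕ≤toℕ v 1+u≤v)) u→→v

  module _ (3≤n : 3 ≤ n) where

    toℕ-firstThree : ∀ j → toℕ (firstThree 3≤n j) ≡ toℕ j
    toℕ-firstThree j = toℕ-inject≤ j 3≤n

    firstThree-shift : ∀ d {i j} → d + toℕ i ≡ toℕ j → d + toℕ (firstThree 3≤n i) ≡ toℕ (firstThree 3≤n j)
    firstThree-shift d {i} {j} e = trans (cong (d +_) (toℕ-firstThree i)) (trans e (sym (toℕ-firstThree j)))

    firstThree-injective : Injective _≡_ _≡_ (c ∘ firstThree 3≤n)
    firstThree-injective {zero} {zero} _ = refl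
    firstThree-injective {suc zero} {suc zero} _ = refl
    firstThree-injective {suc (suc zero)} {suc (suc zero)} _ = refl
    firstThree-injective {zero} {suc zero} e = contradiction e (adjacent-differ (firstThree-shift 1 refl))
    firstThree-injective {suc zero} {suc (suc zero)} e = contradiction e (adjacent-differ (firstThree-shift 1 refl))
    firstThree-injective {zero} {suc (suc zero)} e = contradiction e (distance-two-differ (firstThree-shift 2 refl))
    firstThree-injective {suc zero} {zero} e = contradiction (sym e) (adjacent-differ (firstThree-shift 1 refl))
    firstThree-injective {suc (suc zero)} {suc zero} e = contradiction (sym e) (adjacent-differ (firstThree-shift 1 refl))
    firstThree-injective {suc (suc zero)} {zero} e = contradiction (sym e) (distance-two-differ (firstThree-shift 2 refl))

module PathColouring₃ {n} {c : Fin n → Fin 3} (col : IsConditionalColouring (Path n) 3 2 c) where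
  open PathColouring col

  period-three : ∀ {w u} → 3 + toℕ w ≡ toℕ u → c u ≡ c w
  period-three {w} {u} w→→→u =
    Fin3-≢-≢⇒≡ (adjacent-differ w→p) (adjacent-differ p→q) (distance-two-differ w→→q)
               (distance-two-differ p→→u ∘ sym) (adjacent-differ q→u ∘ sym)
    where
    1+w≤u : suc (toℕ w) ≤ toℕ u
    1+w≤u = ≤-trans (m≤n+m _ 2) (≤-reflexive w→→→u)
    2+w≤u : 2 + toℕ w ≤ toℕ u
    2+w≤u = ≤-trans (m≤n+m _ 1) (≤-reflexive w→→→u)
    p q : Fin n
    p = fromℕ≤toℕ u 1+w≤u
    q = fromℕ≤toℕ u 2+w≤u
    w→p : suc (toℕ w) ≡ toℕ p
    w→p = sym (toℕ-fromℕ≤toℕ u 1+w≤u)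
    w→→q : 2 + toℕ w ≡ toℕ q
    w→→q = sym (toℕ-fromℕ≤toℕ u 2+w≤u)
    p→q : suc (toℕ p) ≡ toℕ q
    p→q = trans (cong suc (sym w→p)) w→→q
    q→u : suc (toℕ q) ≡ toℕ u
    q→u = trans (cong suc (sym w→→q)) w→→→u
    p→→u : 2 + toℕ p ≡ toℕ u
    p→→u = trans (cong (2 +_) (sym w→p)) w→→→u

  module _ (3≤n : 3 ≤ n) where

    colour≡firstThree-mod₃ : ∀ u → c u ≡ c (firstThree 3≤n (mod₃ (toℕ u)))
    colour≡firstThree-mod₃ u = go (toℕ u) refl
      where
      initial : ∀ j {u} → toℕ u ≡ toℕ j → c u ≡ c (firstThree 3≤n j)
      initial j e = cong c (toℕ-injective (trans e (sym (toℕ-firstThree 3≤n j))))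

      go : ∀ m {u} → toℕ u ≡ m → c u ≡ c (firstThree 3≤n (mod₃ m))
      go 0 = initial zero
      go 1 = initial (suc zero)
      go 2 = initial (suc (suc zero))
      go (suc (suc (suc m))) {u} e = begin
        c u                                   ≡⟨ period-three (trans (cong (3 +_) (toℕ-fromℕ≤toℕ u m≤u)) (sym e)) ⟩
        c w                                   ≡⟨ go m (toℕ-fromℕ≤toℕ u m≤u) ⟩
        c (firstThree 3≤n (mod₃ m))           ≡⟨ cong (c ∘ firstThree 3≤n) (sym (next₃³ (mod₃ m))) ⟩
        c (firstThree 3≤n (mod₃ (3 + m)))     ∎
        where
        open ≡-Reasoning
        m≤u : m ≤ toℕ u
        m≤u = ≤-trans (m≤n+m m 3) (≤-reflexive (sym e))
        w : Fin n
        w = fromℕ≤toℕ u m≤u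

    colour-classes : ∀ u v → (c u ≡ c v) ⇔ (mod₃ (toℕ u) ≡ mod₃ (toℕ v))
    colour-classes u v = mk⇔
      (λ e → firstThree-injective 3≤n (trans (sym (colour≡firstThree-mod₃ u)) (trans e (colour≡firstThree-mod₃ v))))
      (λ e → trans (colour≡firstThree-mod₃ u) (trans (cong (c ∘ firstThree 3≤n) e) (sym (colour≡firstThree-mod₃ v))))

mod₃-colouring : ∀ {n} → 3 ≤ n → IsConditionalColouring (Path n) 3 2 (mod₃ ∘ toℕ)
mod₃-colouring {n} 3≤n = record
  { surjective = λ j → firstThree 3≤n j , trans (cong mod₃ (toℕ-inject≤ j 3≤n)) (mod₃-toℕ j)
  ; proper     = proper
  ; condition  = λ v → rainbow⇒condition (Path n) λ x∈ y∈ x≢y → apart-differ (Path-neighbours-apart x∈ y∈ x≢y)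
  }
  where
  proper : ∀ u v → Path n u v ≡ true → mod₃ (toℕ u) ≢ mod₃ (toℕ v)
  proper u v e with Path-edge⁻ {u = u} {v} e
  ... | inj₁ u→v = mod₃-1+-≢ u→v
  ... | inj₂ v→u = mod₃-1+-≢ v→u ∘ sym

  apart-differ : ∀ {x y : Fin n} → 2 + toℕ x ≡ toℕ y ⊎ 2 + toℕ y ≡ toℕ x → mod₃ (toℕ x) ≢ mod₃ (toℕ y)
  apart-differ (inj₁ x→→y) = mod₃-2+-≢ x→→y
  apart-differ (inj₂ y→→x) = mod₃-2+-≢ y→→x ∘ sym

proposition4p3 : ∀ (n : ℕ) → 3 ≤ n → UniquelyColourable (Path n) 3 2
proposition4p3 n 3≤n = ((mod₃ ∘ toℕ , mod₃-colouring 3≤n) , no-colouring-below-3) , same-classes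
  where
  no-colouring-below-3 : ∀ k′ → k′ < 3 → ¬ HasConditionalColouring (Path n) k′ 2
  no-colouring-below-3 k′ k′<3 (c , col) with pigeonhole k′<3 (c ∘ firstThree 3≤n)
  ... | i , j , i<j , cᵢ≡cⱼ = <⇒≢ i<j (PathColouring.firstThree-injective col 3≤n cᵢ≡cⱼ)

  same-classes : ∀ (c c′ : Fin n → Fin 3) → IsConditionalColouring (Path n) 3 2 c →
                 IsConditionalColouring (Path n) 3 2 c′ → ∀ u v → (c u ≡ c v) ⇔ (c′ u ≡ c′ v)
  same-classes c c′ col col′ u v =
    ⇔.trans (PathColouring₃.colour-classes col 3≤n u v) (⇔.sym (PathColouring₃.colour-classes col′ 3≤n u v))
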